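{- Let $p$ be an odd prime, $m\ge1$, $q=p^m$, and let $\gamma\in GF(q^2)$ with $\gamma^2\ne\bar\gamma^2$. Put $s:=\frac{\gamma}{\bar\gamma}+\frac{\bar\gamma}{\gamma}$ and $\kappa:=s^2$, and assume that $\kappa\ne0$ is a square in $GF(q)$ with square root $\sqrt\kappa=s$. Then: (1) If $-1$ is a nonsquare in $GF(q)$, the following are equivalent: $\gamma$ is a square in $GF(q^2)$; $\sqrt\kappa+2$ is a square in $GF(q)$; $-\sqrt\kappa+2$ is a square in $GF(q)$. (2) If $-1$ is a square in $GF(q)$, the following are equivalent: $\gamma$ is a square in $GF(q^2)$; $\sqrt\kappa+2$ is a square in $GF(q)$; $-\sqrt\kappa+2$ is a nonsquare in $GF(q)$.
   Context: $GF(q^2)$ is the quadratic extension of $GF(q)$ and $\bar z:=z^q$ for $z\in GF(q^2)$. -}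

module Defs where

open import Level using (Level; _⊔_; suc)
open import Algebra.Bundles using (CommutativeRing)
open import Data.Nat using (ℕ; zero; suc)
open import Data.Product using (∃; _×_)
open import Relation.Nullary using (¬_)

record Field (c ℓ : Level) : Set (Level.suc (c ⊔ ℓ)) where
  field
    commutativeRing : CommutativeRing c ℓ
  open CommutativeRing commutativeRing public
  field
    _⁻¹      : Carrier → Carrier
    ⁻¹-cong  : ∀ {x y} → x ≈ y → x ⁻¹ ≈ y ⁻¹
    inverseʳ : ∀ x → ¬ (x ≈ 0#) → x * x ⁻¹ ≈ 1#
    0≉1      : ¬ (0# ≈ 1#)

module FieldNotions {c ℓ} (F : Field c ℓ) where
  open Field F

  pow : Carrier → ℕ → Carrier
  pow x zero    = 1#
  pow x (suc n) = x * pow x n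

  _/_ : Carrier → Carrier → Carrier
  x / y = x * y ⁻¹

  2# : Carrier
  2# = 1# + 1#

  conj : ℕ → Carrier → Carrier
  conj q z = pow z q

  -- membership in the subfield GF(q) = { x | x^q = x }
  InSub : ℕ → Carrier → Set ℓ
  InSub q x = pow x q ≈ x

  IsSquare : Carrier → Set (c ⊔ ℓ)
  IsSquare x = ∃ λ y → y * y ≈ x

  IsSquareSub : ℕ → Carrier → Set (c ⊔ ℓ)
  IsSquareSub q x = ∃ λ y → InSub q y × (y * y ≈ x)

-- Write γ̄ = γ ^ q, s = γ/γ̄ + γ̄/γ, and let χ x = x ^ ((q − 1)/2) be the quadratic character of
-- GF(q), the fixed field of the Frobenius x ↦ x ^ q. Then (s + 2) γγ̄ = (γ + γ̄)² and
-- (2 − s) γγ̄ = −(γ − γ̄)², where the Frobenius fixes γ + γ̄ and negates γ − γ̄, so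
-- χ((γ + γ̄)²) = 1 and χ((γ − γ̄)²) = −1. Hence χ(s + 2) = χ(γγ̄) and χ(2 − s) = −χ(−1) χ(γγ̄).
-- By Euler's criterion in GF(q²), γ is a square iff γ ^ ((q² − 1)/2) = χ(γγ̄) is 1, and by Euler's
-- criterion in GF(q), an element of GF(q)* is a square there iff its character is 1; the three
-- equivalences follow. Euler's criterion itself is proved by counting: the (q² − 1)/2 nonzero
-- squares are roots of x ^ ((q² − 1)/2) − 1, which has no more roots than its degree.

module Submission where

open import Defs
open import Level using (Level)
open import Algebra.Bundles using (CommutativeRing; RawRing)
open import Data.Nat as ℕ using (ℕ; zero; suc; _≤_; _<_; z≤n; s≤s; NonZero)
import Data.Nat.Properties as ℕ
open import Data.Nat.Divisibility using (_∣_; divides)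
open import Data.Nat.Primality using (Prime; ¬prime[0]; ¬prime[1]; euclidsLemma; prime⇒irreducible)
open import Data.Nat.Combinatorics using (nCn≡1)
open import Data.Fin as Fin using (Fin)
import Data.Fin.Properties as Fin
open import Data.Fin.Permutation using (Permutation)
open import Data.Vec using (Vec; []; _∷_; replicate)
open import Data.Product using (∃; _,_; proj₂) renaming (_×_ to _∧_)
open import Data.Sum as Sum using (_⊎_; inj₁; inj₂)
open import Data.Empty using (⊥-elim)
open import Function using (_∘_; id)
open import Function.Bundles using (Inverse; mk↔ₛ′; _⇔_; mk⇔; Equivalence)
open import Function.Properties.Inverse using (Inverse⇒Injection)
open import Function.Properties.Equivalence using () renaming (trans to ⇔-trans; sym to ⇔-sym)
import Function.Construct.Symmetry as Symmetry
open import Relation.Nullary using (Dec; yes; no; ¬_; ¬?; _×-dec_)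
open import Relation.Nullary.Decidable using (via-injection)
open import Relation.Nullary.Negation using (contradiction; contraposition)
open import Relation.Binary.Definitions using (Decidable)
open import Relation.Binary.PropositionalEquality as P using (_≡_; _≢_)
import Relation.Binary.Reasoning.Setoid as SetoidReasoning
import Algebra.Properties.CommutativeMonoid.Sum as MonoidSum

-- A ring solver with integer coefficients for any commutative ring. The integer a − b is the pair
-- (a , b), reduced so that a or b is 0, so that equal coefficients are syntactically equal.
module IntegerCoefficientSolver {c ℓ} (R : CommutativeRing c ℓ) where
  open import Data.Product using (_,_) renaming (_×_ to _⊗_)
  open import Data.Maybe using (Maybe; just; nothing)
  open CommutativeRing R
  open import Algebra.Properties.Ring ring using (-‿distribˡ-*; -‿distribʳ-*; -‿involutive; -‿+-comm; -0#≈0#)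
  open import Algebra.Properties.Semiring.Mult semiring using (_×_; ×-homo-+; ×1-homo-*)
  open import Algebra.Solver.Ring.AlmostCommutativeRing using (_-Raw-AlmostCommutative⟶_; fromCommutativeRing)
  open import Algebra.Properties.CommutativeSemigroup +-commutativeSemigroup using () renaming (interchange to +-interchange)
  import Algebra.Solver.Ring.NaturalCoefficients.Default commutativeSemiring as ℕ-Solver
  open import Relation.Binary.Reasoning.Setoid setoid

  reduce : ℕ ⊗ ℕ → ℕ ⊗ ℕ
  reduce (suc a , suc b) = reduce (a , b)
  reduce (a , b)         = (a , b)

  ℤ-rawRing : RawRing _ _
  ℤ-rawRing = record
    { Carrier = ℕ ⊗ ℕ ; _≈_ = _≡_
    ; _+_ = λ { (a , b) (c , d) → reduce (a ℕ.+ c , b ℕ.+ d) }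
    ; _*_ = λ { (a , b) (c , d) → reduce (a ℕ.* c ℕ.+ b ℕ.* d , a ℕ.* d ℕ.+ b ℕ.* c) }
    ; -_  = λ { (a , b) → (b , a) }
    ; 0#  = (0 , 0) ; 1# = (1 , 0) }

  ι : ℕ → Carrier
  ι n = n × 1#

  ⟦_⟧ : ℕ ⊗ ℕ → Carrier
  ⟦ (a , b) ⟧ = ι a - ι b

  -- The evaluation used by the solver: ⟦_⟧ up to ≈, but (0 , 0), (1 , 0) and (2 , 0) evaluate
  -- to 0#, 1# and 1# + 1# on the nose, so constants in goals match without rewriting.
  ι′ : ℕ → Carrier
  ι′ zero          = 0#
  ι′ (suc zero)    = 1#
  ι′ (suc (suc n)) = 1# + ι′ (suc n)

  ⟦_⟧′ : ℕ ⊗ ℕ → Carrier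
  ⟦ (a , zero) ⟧′  = ι′ a
  ⟦ (a , suc b) ⟧′ = ι′ a - ι′ (suc b)

  ι′≈ι : ∀ n → ι′ n ≈ ι n
  ι′≈ι zero          = refl
  ι′≈ι (suc zero)    = sym (+-identityʳ 1#)
  ι′≈ι (suc (suc n)) = +-congˡ (ι′≈ι (suc n))

  ⟦⟧′≈⟦⟧ : ∀ x → ⟦ x ⟧′ ≈ ⟦ x ⟧
  ⟦⟧′≈⟦⟧ (a , zero)  = trans (ι′≈ι a) (sym (trans (+-congˡ -0#≈0#) (+-identityʳ _)))
  ⟦⟧′≈⟦⟧ (a , suc b) = +-cong (ι′≈ι a) (-‿cong (ι′≈ι (suc b)))

  ⟦⟧-+ : ∀ a b c d → ⟦ (a ℕ.+ c , b ℕ.+ d) ⟧ ≈ ⟦ (a , b) ⟧ + ⟦ (c , d) ⟧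
  ⟦⟧-+ a b c d = begin
      ι (a ℕ.+ c) - ι (b ℕ.+ d)            ≈⟨ +-cong (×-homo-+ 1# a c) (-‿cong (×-homo-+ 1# b d)) ⟩
      (ι a + ι c) - (ι b + ι d)            ≈⟨ +-congˡ (sym (-‿+-comm (ι b) (ι d))) ⟩
      (ι a + ι c) + (- ι b + - ι d)        ≈⟨ +-interchange (ι a) (ι c) (- ι b) (- ι d) ⟩
      (ι a - ι b) + (ι c - ι d)            ∎

  ⟦⟧-* : ∀ a b c d → ⟦ (a ℕ.* c ℕ.+ b ℕ.* d , a ℕ.* d ℕ.+ b ℕ.* c) ⟧ ≈ ⟦ (a , b) ⟧ * ⟦ (c , d) ⟧
  ⟦⟧-* a b c d = begin
      ι (a ℕ.* c ℕ.+ b ℕ.* d) - ι (a ℕ.* d ℕ.+ b ℕ.* c)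
        ≈⟨ +-cong (×-homo-+ 1# (a ℕ.* c) (b ℕ.* d)) (-‿cong (×-homo-+ 1# (a ℕ.* d) (b ℕ.* c))) ⟩
      (ι (a ℕ.* c) + ι (b ℕ.* d)) - (ι (a ℕ.* d) + ι (b ℕ.* c))
        ≈⟨ +-cong (+-cong (×1-homo-* a c) (×1-homo-* b d)) (-‿cong (+-cong (×1-homo-* a d) (×1-homo-* b c))) ⟩
      (A * C + B * D) - (A * D + B * C)
        ≈⟨ +-congˡ (sym (-‿+-comm (A * D) (B * C))) ⟩
      (A * C + B * D) + (- (A * D) + - (B * C))
        ≈⟨ +-cong (+-congˡ (sym neg*neg)) (+-cong (-‿distribʳ-* A D) (-‿distribˡ-* B C)) ⟩
      (A * C + - B * - D) + (A * - D + - B * C)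
        ≈⟨ ℕ-Solver.solve 4 (λ A C B D → (A :* C :+ B :* D) :+ (A :* D :+ B :* C) := (A :+ B) :* (C :+ D))
                            refl A C (- B) (- D) ⟩
      (A - B) * (C - D) ∎
    where
    open ℕ-Solver using (_:+_; _:*_; _:=_)
    A = ι a ; B = ι b ; C = ι c ; D = ι d
    neg*neg : - B * - D ≈ B * D
    neg*neg = trans (sym (-‿distribˡ-* B (- D))) (trans (-‿cong (sym (-‿distribʳ-* B D))) (-‿involutive _))

  ⟦⟧-neg : ∀ a b → ⟦ (b , a) ⟧ ≈ - ⟦ (a , b) ⟧
  ⟦⟧-neg a b = begin
      ι b - ι a          ≈⟨ +-comm _ _ ⟩
      - ι a + ι b        ≈⟨ +-congˡ (sym (-‿involutive _)) ⟩
      - ι a + - - ι b    ≈⟨ -‿+-comm _ _ ⟩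
      - (ι a - ι b)      ∎

  ⟦⟧-cancel : ∀ a b c d → a ℕ.+ d ≡ c ℕ.+ b → ⟦ (a , b) ⟧ ≈ ⟦ (c , d) ⟧
  ⟦⟧-cancel a b c d a+d≡c+b = begin
      ι a - ι b                     ≈⟨ sym (+-identityʳ _) ⟩
      (ι a - ι b) + 0#              ≈⟨ +-congˡ (sym (-‿inverseʳ (ι d))) ⟩
      (ι a - ι b) + (ι d - ι d)     ≈⟨ +-interchange (ι a) (- ι b) (ι d) (- ι d) ⟩
      (ι a + ι d) + (- ι b - ι d)   ≈⟨ +-congʳ ιa+ιd≈ιc+ιb ⟩
      (ι c + ι b) + (- ι b - ι d)   ≈⟨ +-congˡ (+-comm (- ι b) (- ι d)) ⟩
      (ι c + ι b) + (- ι d - ι b)   ≈⟨ +-interchange (ι c) (ι b) (- ι d) (- ι b) ⟩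
      (ι c - ι d) + (ι b - ι b)     ≈⟨ +-congˡ (-‿inverseʳ (ι b)) ⟩
      (ι c - ι d) + 0#              ≈⟨ +-identityʳ _ ⟩
      ι c - ι d                     ∎
    where
    ιa+ιd≈ιc+ιb : ι a + ι d ≈ ι c + ι b
    ιa+ιd≈ιc+ιb = trans (sym (×-homo-+ 1# a d)) (trans (reflexive (P.cong ι a+d≡c+b)) (×-homo-+ 1# c b))

  ⟦⟧-reduce : ∀ x → ⟦ reduce x ⟧ ≈ ⟦ x ⟧
  ⟦⟧-reduce (zero , b)        = refl
  ⟦⟧-reduce (suc a , zero)    = refl
  ⟦⟧-reduce (suc a , suc b)   = trans (⟦⟧-reduce (a , b)) (⟦⟧-cancel a b (suc a) (suc b) (ℕ.+-suc a b))

  ⟦reduce⟧′ : ∀ x → ⟦ reduce x ⟧′ ≈ ⟦ x ⟧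
  ⟦reduce⟧′ x = trans (⟦⟧′≈⟦⟧ (reduce x)) (⟦⟧-reduce x)

  ℤ⟶R : ℤ-rawRing -Raw-AlmostCommutative⟶ fromCommutativeRing R
  ℤ⟶R = record
    { ⟦_⟧    = ⟦_⟧′
    ; +-homo = λ { (a , b) (c , d) → trans (⟦reduce⟧′ (a ℕ.+ c , b ℕ.+ d))
                                       (trans (⟦⟧-+ a b c d) (sym (+-cong (⟦⟧′≈⟦⟧ (a , b)) (⟦⟧′≈⟦⟧ (c , d))))) }
    ; *-homo = λ { (a , b) (c , d) → trans (⟦reduce⟧′ (a ℕ.* c ℕ.+ b ℕ.* d , a ℕ.* d ℕ.+ b ℕ.* c))
                                       (trans (⟦⟧-* a b c d) (sym (*-cong (⟦⟧′≈⟦⟧ (a , b)) (⟦⟧′≈⟦⟧ (c , d))))) }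
    ; -‿homo = λ { (a , b) → trans (⟦⟧′≈⟦⟧ (b , a)) (trans (⟦⟧-neg a b) (sym (-‿cong (⟦⟧′≈⟦⟧ (a , b))))) }
    ; 0-homo = refl
    ; 1-homo = refl }

  _≟ℤ_ : ∀ x y → Maybe (⟦ x ⟧′ ≈ ⟦ y ⟧′)
  (a , b) ≟ℤ (c , d) with a ℕ.+ d ℕ.≟ c ℕ.+ b
  ... | no _  = nothing
  ... | yes e = just (trans (⟦⟧′≈⟦⟧ (a , b)) (trans (⟦⟧-cancel a b c d e) (sym (⟦⟧′≈⟦⟧ (c , d)))))

  open import Algebra.Solver.Ring ℤ-rawRing (fromCommutativeRing R) ℤ⟶R _≟ℤ_ public
    using (solve; _:+_; _:*_; :-_; _:-_; _:=_; con)

module Binomial where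
  open import Data.Nat using (ℕ; zero; suc; _<_; _!; _∸_; _*_)
  open import Data.Nat.Properties using (<⇒≱; <⇒≤; <-trans; n<1+n; ∸-monoʳ-<; _!*_!≢0)
  open import Data.Nat.Divisibility using (_∣_; ∣1⇒≡1; ∣⇒≤; m∣m*n)
  open import Data.Nat.Combinatorics using (_C_; nCk≡n!/k![n-k]!; k![n∸k]!∣n!)
  open import Data.Nat.DivMod using (m/n*n≡m)

  prime∤! : ∀ {p} → Prime p → ∀ j → j < p → ¬ p ∣ j !
  prime∤! pp zero    _   p∣1   = ¬prime[1] (P.subst Prime (∣1⇒≡1 p∣1) pp)
  prime∤! pp (suc j) j<p p∣j+1! with euclidsLemma (suc j) (j !) pp p∣j+1!
  ... | inj₁ p∣j+1 = <⇒≱ j<p (∣⇒≤ p∣j+1)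
  ... | inj₂ p∣j!  = prime∤! pp j (<-trans (n<1+n j) j<p) p∣j!

  -- p divides p! = (p C k) · k! · (p − k)! but neither k! nor (p − k)!.
  prime∣choose : ∀ {p k} → Prime p → 0 < k → k < p → p ∣ p C k
  prime∣choose {zero}  pp _   _   = ⊥-elim (¬prime[0] pp)
  prime∣choose {suc p} {k} pp 0<k k<p with euclidsLemma (suc p C k) (k ! * (suc p ∸ k) !) pp p∣product
    where
    instance _ = k !* (suc p ∸ k) !≢0
    p∣product : suc p ∣ (suc p C k) * (k ! * (suc p ∸ k) !)
    p∣product = P.subst (suc p ∣_)
      (P.sym (P.trans (P.cong (_* (k ! * (suc p ∸ k) !)) (nCk≡n!/k![n-k]! (<⇒≤ k<p))) (m/n*n≡m (k![n∸k]!∣n! (<⇒≤ k<p)))))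
      (m∣m*n (p !))
  ... | inj₁ p∣C = p∣C
  ... | inj₂ p∣k![p-k]! with euclidsLemma (k !) ((suc p ∸ k) !) pp p∣k![p-k]!
  ...   | inj₁ p∣k!      = ⊥-elim (prime∤! pp k k<p p∣k!)
  ...   | inj₂ p∣[p-k]!  = ⊥-elim (prime∤! pp (suc p ∸ k) (∸-monoʳ-< 0<k (<⇒≤ k<p)) p∣[p-k]!)

module Parity where
  open import Data.Nat using (ℕ; zero; suc; _+_; _*_; _^_)
  open import Data.Nat.Properties using (*-identityʳ; +-suc)
  open import Data.Nat.Tactic.RingSolver using (solve-∀)

  parity : ∀ n → (∃ λ r → n ≡ r + r) ⊎ (∃ λ r → n ≡ suc (r + r))
  parity zero = inj₁ (0 , P.refl)
  parity (suc n) with parity n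
  ... | inj₁ (r , n≡2r)   = inj₂ (r , P.cong suc n≡2r)
  ... | inj₂ (r , n≡2r+1) = inj₁ (suc r , P.trans (P.cong suc n≡2r+1) (P.cong suc (P.sym (+-suc r r))))

  double≡*2 : ∀ r → r + r ≡ r * 2
  double≡*2 = solve-∀

  odd-prime : ∀ {p} → Prime p → p ≢ 2 → ∃ λ r → p ≡ suc (suc r + suc r)
  odd-prime {p} pp p≢2 with parity p
  ... | inj₂ (suc r , p≡2r+3) = r , p≡2r+3
  ... | inj₂ (zero , P.refl)    = ⊥-elim (¬prime[1] pp)
  ... | inj₁ (r , p≡2r) with prime⇒irreducible pp {2} (divides r (P.trans p≡2r (double≡*2 r)))
  ...   | inj₁ ()
  ...   | inj₂ 2≡p = ⊥-elim (p≢2 (P.sym 2≡p))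

  odd*odd : ∀ r h → suc (suc r + suc r) * suc (suc h + suc h) ≡
                    suc (suc (r * h + r * h + 3 * r + 3 * h + 3) + suc (r * h + r * h + 3 * r + 3 * h + 3))
  odd*odd = solve-∀

  odd-prime-power : ∀ r m → ∃ λ h → suc (suc r + suc r) ^ suc m ≡ suc (suc h + suc h)
  odd-prime-power r zero    = r , *-identityʳ _
  odd-prime-power r (suc m) with odd-prime-power r m
  ... | h , pᵐ⁺¹≡2h+3 = _ , P.trans (P.cong (suc (suc r + suc r) *_) pᵐ⁺¹≡2h+3) (odd*odd r h)

  odd-square : ∀ h → suc (h + h) * suc (h + h) ≡ suc (h * suc (suc (h + h)) + h * suc (suc (h + h)))
  odd-square = solve-∀

  square-of-odd : ∀ {q h} → q ≡ suc (h + h) → q * q ≡ suc (h * suc q + h * suc q)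
  square-of-odd {h = h} P.refl = odd-square h

open Binomial using (prime∣choose)
open Parity using (odd-prime; odd-prime-power; square-of-odd)

module ∑ℕ = MonoidSum ℕ.+-0-commutativeMonoid

∑-mono-≤ : ∀ {m} (f g : Fin m → ℕ) → (∀ i → f i ≤ g i) → ∑ℕ.sum f ≤ ∑ℕ.sum g
∑-mono-≤ {zero}  f g f≤g = z≤n
∑-mono-≤ {suc m} f g f≤g = ℕ.+-mono-≤ (f≤g Fin.zero) (∑-mono-≤ (f ∘ Fin.suc) (g ∘ Fin.suc) (f≤g ∘ Fin.suc))

∑-mono-< : ∀ {m} (f g : Fin m → ℕ) → (∀ i → f i ≤ g i) → ∀ j → f j < g j → ∑ℕ.sum f < ∑ℕ.sum g
∑-mono-< f g f≤g Fin.zero    fj<gj = ℕ.+-mono-<-≤ fj<gj (∑-mono-≤ (f ∘ Fin.suc) (g ∘ Fin.suc) (f≤g ∘ Fin.suc))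
∑-mono-< f g f≤g (Fin.suc j) fj<gj =
  ℕ.+-mono-≤-< (f≤g Fin.zero) (∑-mono-< (f ∘ Fin.suc) (g ∘ Fin.suc) (f≤g ∘ Fin.suc) j fj<gj)

𝟙 : ∀ {a} {A : Set a} → Dec A → ℕ
𝟙 (yes _) = 1
𝟙 (no  _) = 0

𝟙-mono : ∀ {a b} {A : Set a} {B : Set b} (a? : Dec A) (b? : Dec B) → (A → B) → 𝟙 a? ≤ 𝟙 b?
𝟙-mono (no _)  _        _   = z≤n
𝟙-mono (yes _) (yes _)  _   = s≤s z≤n
𝟙-mono (yes a) (no ¬b)  A→B = ⊥-elim (¬b (A→B a))

𝟙-⊎ : ∀ {a b d} {A : Set a} {B : Set b} {D : Set d} (a? : Dec A) (b? : Dec B) (d? : Dec D) →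
      (A → B ⊎ D) → 𝟙 a? ≤ 𝟙 b? ℕ.+ 𝟙 d?
𝟙-⊎ (no _)  _       _       _ = z≤n
𝟙-⊎ (yes _) (yes _) _       _ = s≤s z≤n
𝟙-⊎ (yes a) (no ¬b) d?      A→B⊎D with A→B⊎D a
... | inj₁ b = ⊥-elim (¬b b)
... | inj₂ d = 𝟙-mono (yes d) d? id

𝟙-≡0 : ∀ {a} {A : Set a} (a? : Dec A) → ¬ A → 𝟙 a? ≡ 0
𝟙-≡0 (yes a) ¬a = ⊥-elim (¬a a)
𝟙-≡0 (no _)  _  = P.refl

𝟙-≡1 : ∀ {a} {A : Set a} (a? : Dec A) → A → 𝟙 a? ≡ 1
𝟙-≡1 (yes _) _ = P.refl
𝟙-≡1 (no ¬a) a = ⊥-elim (¬a a)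

∑-≡0 : ∀ {m} (f : Fin m → ℕ) → (∀ i → f i ≡ 0) → ∑ℕ.sum f ≡ 0
∑-≡0 {m} f f≡0 = P.trans (∑ℕ.sum-cong-≗ f≡0) (∑ℕ.sum-replicate-zero m)

∑-single : ∀ {m} (f : Fin m → ℕ) (j : Fin m) → (∀ i → i ≢ j → f i ≡ 0) → ∑ℕ.sum f ≡ f j
∑-single f Fin.zero    fᵢ≡0 = P.trans (P.cong (f Fin.zero ℕ.+_) (∑-≡0 _ λ i → fᵢ≡0 (Fin.suc i) λ ())) (ℕ.+-identityʳ _)
∑-single f (Fin.suc j) fᵢ≡0 =
  P.cong₂ ℕ._+_ (fᵢ≡0 Fin.zero λ ()) (∑-single (f ∘ Fin.suc) j λ i i≢j → fᵢ≡0 (Fin.suc i) (i≢j ∘ Fin.suc-injective))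

module Frobenius {c ℓ} (R : CommutativeRing c ℓ) where
  open CommutativeRing R
  open SetoidReasoning setoid
  open import Algebra.Properties.CommutativeSemiring.Exp commutativeSemiring using (_^_; ^-congˡ; ^-assocʳ)
  open import Algebra.Properties.CommutativeSemiring.Binomial commutativeSemiring
    using (binomialExpansion; binomialTerm) renaming (theorem to binomial-theorem)
  open import Algebra.Properties.Semiring.Mult semiring using (_×_; ×-congʳ; ×-assoc-*; ×1-homo-*)
  module ∑ = MonoidSum +-commutativeMonoid

  multiple-of-char : ∀ {p m} → p × 1# ≈ 0# → ∀ x → p ∣ m → m × x ≈ 0#
  multiple-of-char {p} {m} char-p x (divides d m≡d*p) = begin
    m × x                        ≈⟨ ×-congʳ m (sym (*-identityˡ x)) ⟩
    m × (1# * x)                 ≈⟨ sym (×-assoc-* m 1# x) ⟩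
    (m × 1#) * x                 ≈⟨ *-congʳ (trans (reflexive (P.cong (_× 1#) m≡d*p)) (×1-homo-* d p)) ⟩
    (d × 1#) * (p × 1#) * x      ≈⟨ *-congʳ (*-congˡ char-p) ⟩
    (d × 1#) * 0# * x            ≈⟨ *-congʳ (zeroʳ _) ⟩
    0# * x                       ≈⟨ zeroˡ x ⟩
    0#                           ∎

  ∑-last : ∀ {m} (f : Fin (suc m) → Carrier) → (∀ i → i ≢ Fin.fromℕ m → f i ≈ 0#) → ∑.sum f ≈ f (Fin.fromℕ m)
  ∑-last {zero}  f fᵢ≈0 = +-identityʳ _
  ∑-last {suc m} f fᵢ≈0 = trans (+-congʳ (fᵢ≈0 Fin.zero λ ())) (trans (+-identityˡ _)
                            (∑-last (f ∘ Fin.suc) λ i i≢last → fᵢ≈0 (Fin.suc i) (i≢last ∘ Fin.suc-injective)))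

  -- Only the two outer binomial coefficients of (x + y) ^ p survive, since p ∣ p C k for 0 < k < p.
  freshmans-dream : ∀ {p} → Prime p → p × 1# ≈ 0# → ∀ x y → (x + y) ^ p ≈ x ^ p + y ^ p
  freshmans-dream {zero}   pp _      _ _ = ⊥-elim (¬prime[0] pp)
  freshmans-dream {suc p′} pp char-p x y = begin
    (x + y) ^ suc p′                                                   ≈⟨ binomial-theorem (suc p′) x y ⟩
    binomialExpansion x y (suc p′)                                     ≈⟨ +-congʳ (trans (+-identityʳ _) (*-identityˡ _)) ⟩
    y ^ suc p′ + ∑.sum (binomialTerm x y (suc p′) ∘ Fin.suc)            ≈⟨ +-congˡ (∑-last _ inner≈0) ⟩
    y ^ suc p′ + binomialTerm x y (suc p′) (Fin.suc (Fin.fromℕ p′))     ≈⟨ +-congˡ last≈xᵖ ⟩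
    y ^ suc p′ + x ^ suc p′                                            ≈⟨ +-comm _ _ ⟩
    x ^ suc p′ + y ^ suc p′                                            ∎
    where
    last≈xᵖ : binomialTerm x y (suc p′) (Fin.suc (Fin.fromℕ p′)) ≈ x ^ suc p′
    last≈xᵖ rewrite Fin.toℕ-fromℕ p′ | nCn≡1 (suc p′) | ℕ.n∸n≡0 p′ = trans (+-identityʳ _) (*-identityʳ _)
    inner≈0 : ∀ i → i ≢ Fin.fromℕ p′ → binomialTerm x y (suc p′) (Fin.suc i) ≈ 0#
    inner≈0 i i≢p′ = multiple-of-char char-p _ (prime∣choose pp (s≤s z≤n) (s≤s i<p′))
      where
      i<p′ : Fin.toℕ i < p′
      i<p′ with ℕ.m≤n⇒m<n∨m≡n (ℕ.≤-pred (Fin.toℕ<n i))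
      ... | inj₁ i<p′  = i<p′
      ... | inj₂ i≡p′  = ⊥-elim (i≢p′ (Fin.toℕ-injective (P.trans i≡p′ (P.sym (Fin.toℕ-fromℕ p′)))))

  frobenius : ∀ {p} → Prime p → p × 1# ≈ 0# → ∀ m x y → (x + y) ^ (p ℕ.^ m) ≈ x ^ (p ℕ.^ m) + y ^ (p ℕ.^ m)
  frobenius pp char-p zero    x y = trans (*-identityʳ _) (sym (+-cong (*-identityʳ _) (*-identityʳ _)))
  frobenius {p} pp char-p (suc m) x y = begin
    (x + y) ^ (p ℕ.* p ℕ.^ m)                       ≈⟨ sym (^-assocʳ (x + y) p (p ℕ.^ m)) ⟩
    ((x + y) ^ p) ^ (p ℕ.^ m)                       ≈⟨ ^-congˡ (p ℕ.^ m) (freshmans-dream pp char-p x y) ⟩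
    (x ^ p + y ^ p) ^ (p ℕ.^ m)                     ≈⟨ frobenius pp char-p m (x ^ p) (y ^ p) ⟩
    (x ^ p) ^ (p ℕ.^ m) + (y ^ p) ^ (p ℕ.^ m)       ≈⟨ +-cong (^-assocʳ x p (p ℕ.^ m)) (^-assocʳ y p (p ℕ.^ m)) ⟩
    x ^ (p ℕ.* p ℕ.^ m) + y ^ (p ℕ.* p ℕ.^ m)       ∎

module FieldProperties {c ℓ} (F : Field c ℓ) where
  open Field F
  open FieldNotions F
  open SetoidReasoning setoid
  open import Algebra.Properties.CommutativeSemiring.Exp commutativeSemiring using (_^_; ^-congˡ; ^-homo-*; ^-assocʳ; ^-distrib-*)
  open import Algebra.Properties.Semiring.Mult semiring using (_×_; ×1-homo-*)
  open import Algebra.Properties.Ring ring using (-‿injective; -‿distribʳ-*)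

  1≉0 : 1# ≉ 0#
  1≉0 1≈0 = 0≉1 (sym 1≈0)

  ⁻¹-inverseˡ : ∀ {x} → x ≉ 0# → x ⁻¹ * x ≈ 1#
  ⁻¹-inverseˡ {x} x≉0 = trans (*-comm _ _) (inverseʳ x x≉0)

  *-cancelˡ : ∀ {x a b} → x ≉ 0# → x * a ≈ x * b → a ≈ b
  *-cancelˡ {x} {a} {b} x≉0 xa≈xb = begin
    a               ≈⟨ sym (*-identityˡ a) ⟩
    1# * a          ≈⟨ *-congʳ (sym (⁻¹-inverseˡ x≉0)) ⟩
    x ⁻¹ * x * a    ≈⟨ *-assoc _ _ _ ⟩
    x ⁻¹ * (x * a)  ≈⟨ *-congˡ xa≈xb ⟩
    x ⁻¹ * (x * b)  ≈⟨ sym (*-assoc _ _ _) ⟩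
    x ⁻¹ * x * b    ≈⟨ *-congʳ (⁻¹-inverseˡ x≉0) ⟩
    1# * b          ≈⟨ *-identityˡ b ⟩
    b               ∎

  *-cancelʳ : ∀ {x a b} → x ≉ 0# → a * x ≈ b * x → a ≈ b
  *-cancelʳ x≉0 ax≈bx = *-cancelˡ x≉0 (trans (*-comm _ _) (trans ax≈bx (*-comm _ _)))

  *-≉0 : ∀ {x y} → x ≉ 0# → y ≉ 0# → x * y ≉ 0#
  *-≉0 {x} x≉0 y≉0 xy≈0 = y≉0 (*-cancelˡ x≉0 (trans xy≈0 (sym (zeroʳ x))))

  root-≉0 : ∀ {x y} → y * y ≈ x → x ≉ 0# → y ≉ 0#
  root-≉0 {y = y} y²≈x x≉0 y≈0 = x≉0 (trans (sym y²≈x) (trans (*-congʳ y≈0) (zeroˡ y)))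

  pow≈^ : ∀ x n → pow x n ≈ x ^ n
  pow≈^ x zero    = refl
  pow≈^ x (suc n) = *-congˡ (pow≈^ x n)

  pow-cong : ∀ n {x y} → x ≈ y → pow x n ≈ pow y n
  pow-cong n {x} {y} x≈y = trans (pow≈^ x n) (trans (^-congˡ n x≈y) (sym (pow≈^ y n)))

  pow-+ : ∀ x m n → pow x (m ℕ.+ n) ≈ pow x m * pow x n
  pow-+ x m n = trans (pow≈^ x (m ℕ.+ n)) (trans (^-homo-* x m n) (sym (*-cong (pow≈^ x m) (pow≈^ x n))))

  pow-* : ∀ x m n → pow x (m ℕ.* n) ≈ pow (pow x m) n
  pow-* x m n = trans (pow≈^ x (m ℕ.* n)) (trans (sym (^-assocʳ x m n)) (sym (trans (pow≈^ _ n) (^-congˡ n (pow≈^ x m)))))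

  pow-distrib-* : ∀ x y n → pow (x * y) n ≈ pow x n * pow y n
  pow-distrib-* x y n = trans (pow≈^ _ n) (trans (^-distrib-* x y n) (sym (*-cong (pow≈^ x n) (pow≈^ y n))))

  pow-1# : ∀ n → pow 1# n ≈ 1#
  pow-1# zero    = refl
  pow-1# (suc n) = trans (*-identityˡ _) (pow-1# n)

  pow-≉0 : ∀ n {x} → x ≉ 0# → pow x n ≉ 0#
  pow-≉0 zero    x≉0 = 1≉0
  pow-≉0 (suc n) x≉0 = *-≉0 x≉0 (pow-≉0 n x≉0)

  pow-square : ∀ x n → pow (x * x) n ≈ pow x (n ℕ.+ n)
  pow-square x n = trans (pow-distrib-* x x n) (sym (pow-+ x n n))

  x*y≈1⇒x≈1⇔y≈1 : ∀ {x y} → x * y ≈ 1# → (x ≈ 1# ⇔ y ≈ 1#)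
  x*y≈1⇒x≈1⇔y≈1 {x} {y} xy≈1 = mk⇔
    (λ x≈1 → trans (sym (*-identityˡ y)) (trans (*-congʳ (sym x≈1)) xy≈1))
    (λ y≈1 → trans (sym (*-identityʳ x)) (trans (*-congˡ (sym y≈1)) xy≈1))

  x*y≈-1⇒x≈1⇔y≉1 : ∀ {x y} → 1# ≉ - 1# → y ≈ 1# ⊎ y ≈ - 1# → x * y ≈ - 1# → (x ≈ 1# ⇔ y ≉ 1#)
  x*y≈-1⇒x≈1⇔y≉1 {x} {y} 1≉-1 y≈±1 xy≈-1 = mk⇔
    (λ x≈1 y≈1 → 1≉-1 (trans (sym (*-identityˡ 1#)) (trans (sym (*-cong x≈1 y≈1)) xy≈-1)))
    (λ y≉1 → Sum.[ (λ y≈1 → ⊥-elim (y≉1 y≈1))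
                 , (λ y≈-1 → -‿injective (trans (sym (x*-1≈-x x)) (trans (*-congˡ (sym y≈-1)) xy≈-1))) ]′ y≈±1)
    where
    x*-1≈-x : ∀ x → x * - 1# ≈ - x
    x*-1≈-x x = trans (sym (-‿distribʳ-* x 1#)) (-‿cong (*-identityʳ x))

  module _ {x y : Carrier} (x≉0 : x ≉ 0#) (y≉0 : y ≉ 0#) where
    open IntegerCoefficientSolver commutativeRing using (solve; _:+_; _:*_; :-_; _:-_; _:=_; con)

    [x/y+y/x+2]*xy≈[x+y]² : (x / y + y / x + 2#) * (x * y) ≈ (x + y) * (x + y)
    [x/y+y/x+2]*xy≈[x+y]² = begin
      (x / y + y / x + 2#) * (x * y)
        ≈⟨ solve 4 (λ x y x⁻¹ y⁻¹ → (x :* y⁻¹ :+ y :* x⁻¹ :+ con (2 , 0)) :* (x :* y)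
                                 := x :* x :* (y :* y⁻¹) :+ y :* y :* (x :* x⁻¹) :+ con (2 , 0) :* x :* y)
                   refl x y (x ⁻¹) (y ⁻¹) ⟩
      x * x * (y * y ⁻¹) + y * y * (x * x ⁻¹) + 2# * x * y
        ≈⟨ +-congʳ (+-cong (*-congˡ (inverseʳ y y≉0)) (*-congˡ (inverseʳ x x≉0))) ⟩
      x * x * 1# + y * y * 1# + 2# * x * y
        ≈⟨ solve 2 (λ x y → x :* x :* con (1 , 0) :+ y :* y :* con (1 , 0) :+ con (2 , 0) :* x :* y
                           := (x :+ y) :* (x :+ y)) refl x y ⟩
      (x + y) * (x + y) ∎

    [-[x/y+y/x]+2]*xy≈-[x-y]² : (- (x / y + y / x) + 2#) * (x * y) ≈ - 1# * ((x - y) * (x - y))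
    [-[x/y+y/x]+2]*xy≈-[x-y]² = begin
      (- (x / y + y / x) + 2#) * (x * y)
        ≈⟨ solve 4 (λ x y x⁻¹ y⁻¹ → (:- (x :* y⁻¹ :+ y :* x⁻¹) :+ con (2 , 0)) :* (x :* y)
                                 := :- (x :* x :* (y :* y⁻¹) :+ y :* y :* (x :* x⁻¹)) :+ con (2 , 0) :* x :* y)
                   refl x y (x ⁻¹) (y ⁻¹) ⟩
      - (x * x * (y * y ⁻¹) + y * y * (x * x ⁻¹)) + 2# * x * y
        ≈⟨ +-congʳ (-‿cong (+-cong (*-congˡ (inverseʳ y y≉0)) (*-congˡ (inverseʳ x x≉0)))) ⟩
      - (x * x * 1# + y * y * 1#) + 2# * x * y
        ≈⟨ solve 2 (λ x y → :- (x :* x :* con (1 , 0) :+ y :* y :* con (1 , 0)) :+ con (2 , 0) :* x :* y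
                           := :- con (1 , 0) :* ((x :- y) :* (x :- y))) refl x y ⟩
      - 1# * ((x - y) * (x - y)) ∎

  ^×1≈pow : ∀ a n → (a ℕ.^ n) × 1# ≈ pow (a × 1#) n
  ^×1≈pow a zero    = +-identityʳ 1#
  ^×1≈pow a (suc n) = trans (×1-homo-* a (a ℕ.^ n)) (*-congˡ (^×1≈pow a n))

module FiniteField {c ℓ} (F : Field c ℓ) {n : ℕ} (enum : Inverse (P.setoid (Fin n)) (Field.setoid F)) where
  open Field F
  open FieldNotions F
  open FieldProperties F
  open SetoidReasoning setoid
  open IntegerCoefficientSolver commutativeRing using (solve; _:+_; _:*_; :-_; _:-_; _:=_; con)
  open import Algebra.Properties.Ring ring using (x∙y⁻¹≈ε⇒x≈y; +-inverseˡ-unique; +-identityˡ-unique)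
  open import Algebra.Properties.Semiring.Mult semiring using (_×_)
  open import Algebra.Properties.CommutativeSemigroup *-commutativeSemigroup using (x∙yz≈y∙xz)
  open Inverse enum public using (to-cong; from-cong; strictlyInverseˡ; strictlyInverseʳ)
    renaming (to to element; from to index)
  module ∑ = MonoidSum +-commutativeMonoid
  module ∏ = MonoidSum *-commutativeMonoid

  infix 4 _≟_
  _≟_ : Decidable _≈_
  _≟_ = via-injection (Inverse⇒Injection (Symmetry.inverse enum)) Fin._≟_

  *-≈0 : ∀ {x y} → x * y ≈ 0# → x ≈ 0# ⊎ y ≈ 0#
  *-≈0 {x} xy≈0 with x ≟ 0#
  ... | yes x≈0 = inj₁ x≈0
  ... | no  x≉0 = inj₂ (*-cancelˡ x≉0 (trans xy≈0 (sym (zeroʳ x))))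

  difference-of-squares : ∀ x y → (x - y) * (x + y) ≈ x * x - y * y
  difference-of-squares = solve 2 (λ x y → (x :- y) :* (x :+ y) := x :* x :- y :* y) refl

  square-≈ : ∀ {x y} → x * x ≈ y * y → x ≈ y ⊎ x ≈ - y
  square-≈ {x} {y} x²≈y² = Sum.map (x∙y⁻¹≈ε⇒x≈y x y) (+-inverseˡ-unique x y)
    (*-≈0 (trans (difference-of-squares x y) (trans (+-congʳ x²≈y²) (-‿inverseʳ _))))

  pow-≈0 : ∀ m {x} → pow x m ≈ 0# → x ≈ 0#
  pow-≈0 m {x} xᵐ≈0 with x ≟ 0#
  ... | yes x≈0 = x≈0
  ... | no  x≉0 = ⊥-elim (pow-≉0 m x≉0 xᵐ≈0)

  reindexing : (σ σ⁻¹ : Carrier → Carrier) →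
               (∀ {x y} → x ≈ y → σ x ≈ σ y) → (∀ {x y} → x ≈ y → σ⁻¹ x ≈ σ⁻¹ y) →
               (∀ x → σ (σ⁻¹ x) ≈ x) → (∀ x → σ⁻¹ (σ x) ≈ x) → Permutation n n
  reindexing σ σ⁻¹ σ-cong σ⁻¹-cong σσ⁻¹ σ⁻¹σ =
    mk↔ₛ′ (λ i → index (σ (element i))) (λ i → index (σ⁻¹ (element i)))
    (λ i → P.trans (from-cong (trans (σ-cong (strictlyInverseˡ _)) (σσ⁻¹ (element i)))) (strictlyInverseʳ i))
    (λ i → P.trans (from-cong (trans (σ⁻¹-cong (strictlyInverseˡ _)) (σ⁻¹σ (element i)))) (strictlyInverseʳ i))

  -- Translation by 1 permutes the field, so ∑ (1 + x) = ∑ x.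
  characteristic : n × 1# ≈ 0#
  characteristic = +-identityˡ-unique (n × 1#) (∑.sum element) (sym (begin
    ∑.sum element
      ≈⟨ ∑.∑-permute element (reindexing (1# +_) (- 1# +_) +-congˡ +-congˡ 1+[-1+x] -1+[1+x]) ⟩
    ∑.sum {n} (λ i → element (index (1# + element i))) ≈⟨ ∑.sum-cong-≋ (λ i → strictlyInverseˡ (1# + element i)) ⟩
    ∑.sum {n} (λ i → 1# + element i)           ≈⟨ ∑.∑-distrib-+ (λ _ → 1#) element ⟩
    ∑.sum {n} (λ _ → 1#) + ∑.sum element       ≈⟨ +-congʳ (∑.sum-replicate n) ⟩
    n × 1# + ∑.sum element                     ∎))
    where
    1+[-1+x] : ∀ x → 1# + (- 1# + x) ≈ x
    1+[-1+x] = solve 1 (λ x → con (1 , 0) :+ (:- con (1 , 0) :+ x) := x) refl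
    -1+[1+x] : ∀ x → - 1# + (1# + x) ≈ x
    -1+[1+x] = solve 1 (λ x → :- con (1 , 0) :+ (con (1 , 0) :+ x) := x) refl

  -- Fermat's little theorem: for x ≉ 0, y ↦ x y permutes the field, and comparing ∏ u(x y) with
  -- ∏ u(y), where u replaces 0 by 1, gives x ^ (n − 1) ≈ 1.
  unitPart : Carrier → Carrier
  unitPart y with y ≟ 0#
  ... | yes _ = 1#
  ... | no  _ = y

  scaleAwayFrom0 : Carrier → Carrier → Carrier
  scaleAwayFrom0 x y with y ≟ 0#
  ... | yes _ = 1#
  ... | no  _ = x

  unitPart-cong : ∀ {y z} → y ≈ z → unitPart y ≈ unitPart z
  unitPart-cong {y} {z} y≈z with y ≟ 0# | z ≟ 0#
  ... | yes _   | yes _   = refl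
  ... | yes y≈0 | no  z≉0 = ⊥-elim (z≉0 (trans (sym y≈z) y≈0))
  ... | no  y≉0 | yes z≈0 = ⊥-elim (y≉0 (trans y≈z z≈0))
  ... | no  _   | no  _   = y≈z

  unitPart-≉0 : ∀ y → unitPart y ≉ 0#
  unitPart-≉0 y with y ≟ 0#
  ... | yes _   = 1≉0
  ... | no  y≉0 = y≉0

  unitPart-* : ∀ {x} → x ≉ 0# → ∀ y → unitPart (x * y) ≈ scaleAwayFrom0 x y * unitPart y
  unitPart-* {x} x≉0 y with y ≟ 0# | x * y ≟ 0#
  ... | yes _   | yes _    = sym (*-identityˡ _)
  ... | yes y≈0 | no  xy≉0 = ⊥-elim (xy≉0 (trans (*-congˡ y≈0) (zeroʳ x)))
  ... | no  y≉0 | yes xy≈0 = ⊥-elim (*-≉0 x≉0 y≉0 xy≈0)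
  ... | no  _   | no  _    = refl

  scaleAwayFrom0-0 : ∀ x {y} → y ≈ 0# → scaleAwayFrom0 x y ≈ 1#
  scaleAwayFrom0-0 x {y} y≈0 with y ≟ 0#
  ... | yes _   = refl
  ... | no  y≉0 = ⊥-elim (y≉0 y≈0)

  scaleAwayFrom0-≉0 : ∀ x {y} → y ≉ 0# → scaleAwayFrom0 x y ≈ x
  scaleAwayFrom0-≉0 x {y} y≉0 with y ≟ 0#
  ... | yes y≈0 = ⊥-elim (y≉0 y≈0)
  ... | no  _   = refl

  ∏-≉0 : ∀ {m} (f : Fin m → Carrier) → (∀ i → f i ≉ 0#) → ∏.sum f ≉ 0#
  ∏-≉0 {zero}  f f≉0 = 1≉0
  ∏-≉0 {suc m} f f≉0 = *-≉0 (f≉0 Fin.zero) (∏-≉0 (f ∘ Fin.suc) (f≉0 ∘ Fin.suc))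

  -- The product is x ^ (m − 1), stated without a predecessor.
  ∏-constant-but-one : ∀ {m} (f : Fin m → Carrier) (j : Fin m) {x} → f j ≈ 1# → (∀ i → i ≢ j → f i ≈ x) →
                       x * ∏.sum f ≈ pow x m
  ∏-constant-but-one f Fin.zero {x} fj≈1 fi≈x =
    *-congˡ (trans (*-congʳ fj≈1) (trans (*-identityˡ _) (∏-constant (f ∘ Fin.suc) (λ i → fi≈x (Fin.suc i) λ ()))))
    where
    ∏-constant : ∀ {m} (g : Fin m → Carrier) → (∀ i → g i ≈ x) → ∏.sum g ≈ pow x m
    ∏-constant {zero}  g g≈x = refl
    ∏-constant {suc m} g g≈x = *-cong (g≈x Fin.zero) (∏-constant (g ∘ Fin.suc) (g≈x ∘ Fin.suc))
  ∏-constant-but-one {suc m} f (Fin.suc j) {x} fj≈1 fi≈x = begin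
    x * (f Fin.zero * ∏.sum (f ∘ Fin.suc))  ≈⟨ x∙yz≈y∙xz x _ _ ⟩
    f Fin.zero * (x * ∏.sum (f ∘ Fin.suc))
      ≈⟨ *-cong (fi≈x Fin.zero λ ()) (∏-constant-but-one (f ∘ Fin.suc) j fj≈1 fi≈x′) ⟩
    x * pow x m                             ∎
    where
    fi≈x′ : ∀ i → i ≢ j → f (Fin.suc i) ≈ x
    fi≈x′ i i≢j = fi≈x (Fin.suc i) (i≢j ∘ Fin.suc-injective)

  ∏-scaleAwayFrom0 : ∀ {x} → x ≉ 0# → ∏.sum (λ i → scaleAwayFrom0 x (element i)) ≈ 1#
  ∏-scaleAwayFrom0 {x} x≉0 = *-cancelʳ (∏-≉0 (unitPart ∘ element) (unitPart-≉0 ∘ element)) (begin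
    ∏.sum (λ i → scaleAwayFrom0 x (element i)) * ∏.sum (unitPart ∘ element)
      ≈⟨ sym (∏.∑-distrib-+ (λ i → scaleAwayFrom0 x (element i)) (unitPart ∘ element)) ⟩
    ∏.sum (λ i → scaleAwayFrom0 x (element i) * unitPart (element i))
      ≈⟨ sym (∏.sum-cong-≋ λ i → trans (unitPart-cong (strictlyInverseˡ _)) (unitPart-* x≉0 (element i))) ⟩
    ∏.sum (λ i → unitPart (element (index (x * element i))))
      ≈⟨ sym (∏.∑-permute (unitPart ∘ element) (reindexing (x *_) (x ⁻¹ *_) *-congˡ *-congˡ x*[x⁻¹*y] x⁻¹*[x*y])) ⟩
    ∏.sum (unitPart ∘ element)
      ≈⟨ sym (*-identityˡ _) ⟩
    1# * ∏.sum (unitPart ∘ element) ∎)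
    where
    x*[x⁻¹*y] : ∀ y → x * (x ⁻¹ * y) ≈ y
    x*[x⁻¹*y] y = trans (sym (*-assoc _ _ _)) (trans (*-congʳ (inverseʳ x x≉0)) (*-identityˡ y))
    x⁻¹*[x*y] : ∀ y → x ⁻¹ * (x * y) ≈ y
    x⁻¹*[x*y] y = trans (sym (*-assoc _ _ _)) (trans (*-congʳ (⁻¹-inverseˡ x≉0)) (*-identityˡ y))

  fermat : ∀ {x} → x ≉ 0# → pow x n ≈ x
  fermat {x} x≉0 = begin
    pow x n
      ≈⟨ sym (∏-constant-but-one _ (index 0#) (scaleAwayFrom0-0 x (strictlyInverseˡ 0#)) scale≈x) ⟩
    x * ∏.sum (λ i → scaleAwayFrom0 x (element i))  ≈⟨ *-congˡ (∏-scaleAwayFrom0 x≉0) ⟩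
    x * 1#                                          ≈⟨ *-identityʳ x ⟩
    x                                               ∎
    where
    scale≈x : ∀ i → i ≢ index 0# → scaleAwayFrom0 x (element i) ≈ x
    scale≈x i i≢0 = scaleAwayFrom0-≉0 x λ eᵢ≈0 → i≢0 (P.trans (P.sym (strictlyInverseʳ i)) (from-cong eᵢ≈0))

module Counting {c ℓ} (F : Field c ℓ) {n : ℕ} (enum : Inverse (P.setoid (Fin n)) (Field.setoid F)) where
  open Field F
  open FieldNotions F
  open FieldProperties F
  open FiniteField F enum
  open IntegerCoefficientSolver commutativeRing using (solve; _:+_; _:*_; :-_; _:=_; con)

  count : ∀ {a} {Q : Carrier → Set a} → (∀ x → Dec (Q x)) → ℕ
  count Q? = ∑ℕ.sum {n} (λ i → 𝟙 (Q? (element i)))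

  module _ {a b} {Q : Carrier → Set a} {R : Carrier → Set b} (Q? : ∀ x → Dec (Q x)) (R? : ∀ x → Dec (R x)) where

    count-mono : (∀ {x} → Q x → R x) → count Q? ≤ count R?
    count-mono Q⇒R = ∑-mono-≤ _ _ λ i → 𝟙-mono (Q? (element i)) (R? (element i)) Q⇒R

    count-mono-< : (∀ {x} → Q x → R x) → ∀ i → ¬ Q (element i) → R (element i) → count Q? < count R?
    count-mono-< Q⇒R i ¬Qᵢ Rᵢ = ∑-mono-< _ _ (λ i → 𝟙-mono (Q? (element i)) (R? (element i)) Q⇒R) i
      (P.subst₂ _<_ (P.sym (𝟙-≡0 (Q? (element i)) ¬Qᵢ)) (P.sym (𝟙-≡1 (R? (element i)) Rᵢ)) (s≤s z≤n))

    count-≡ : (∀ {x} → Q x → R x) → (∀ {x} → R x → Q x) → count Q? ≡ count R?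
    count-≡ Q⇒R R⇒Q = ℕ.≤-antisym (count-mono Q⇒R) (∑-mono-≤ _ _ λ i → 𝟙-mono (R? (element i)) (Q? (element i)) R⇒Q)

  count-⊎ : ∀ {a b d} {Q : Carrier → Set a} {R : Carrier → Set b} {D : Carrier → Set d}
            (Q? : ∀ x → Dec (Q x)) (R? : ∀ x → Dec (R x)) (D? : ∀ x → Dec (D x)) →
            (∀ {x} → Q x → R x ⊎ D x) → count Q? ≤ count R? ℕ.+ count D?
  count-⊎ Q? R? D? Q⇒R⊎D = ℕ.≤-trans (∑-mono-≤ _ _ λ i → 𝟙-⊎ (Q? (element i)) (R? (element i)) (D? (element i)) Q⇒R⊎D)
    (ℕ.≤-reflexive (∑ℕ.∑-distrib-+ {n} (λ i → 𝟙 (R? (element i))) (λ i → 𝟙 (D? (element i)))))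

  count-empty : ∀ {a} {Q : Carrier → Set a} (Q? : ∀ x → Dec (Q x)) → (∀ i → ¬ Q (element i)) → count Q? ≡ 0
  count-empty Q? ¬Q = ∑-≡0 _ λ i → 𝟙-≡0 (Q? (element i)) (¬Q i)

  count-≈ : ∀ r → count (_≟ r) ≡ 1
  count-≈ r = P.trans (∑-single _ (index r) λ i i≢r → 𝟙-≡0 (element i ≟ r) (i≢r ∘ index-≈))
                      (𝟙-≡1 (element (index r) ≟ r) (strictlyInverseˡ r))
    where
    index-≈ : ∀ {i} → element i ≈ r → i ≡ index r
    index-≈ {i} eᵢ≈r = P.trans (P.sym (strictlyInverseʳ i)) (from-cong eᵢ≈r)

  -- c₀ + x (c₁ + x (⋯ (c_{d−1} + x))), the monic polynomial of degree d with lower coefficients cs.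
  monic : ∀ {d} → Vec Carrier d → Carrier → Carrier
  monic []       x = 1#
  monic (c ∷ cs) x = c + x * monic cs x

  quotient : ∀ {d} → Carrier → Vec Carrier (suc d) → Vec Carrier d
  quotient r (c ∷ [])      = []
  quotient r (c ∷ c′ ∷ cs) = monic (c′ ∷ cs) r ∷ quotient r (c′ ∷ cs)

  -- f(x) − f(r) = (x − r) q(x), with the subtractions moved across.
  monic-division : ∀ {d} (cs : Vec Carrier (suc d)) r x →
                   monic cs x + r * monic (quotient r cs) x ≈ x * monic (quotient r cs) x + monic cs r
  monic-division (c ∷ [])      r x =
    solve 3 (λ c x r → (c :+ x :* con (1 , 0)) :+ r :* con (1 , 0) := x :* con (1 , 0) :+ (c :+ r :* con (1 , 0))) refl c x r
  monic-division (c ∷ c′ ∷ cs) r x = begin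
      (c + x * f x) + r * (f r + x * q x)
        ≈⟨ solve 6 (λ c x r fx qx fr → (c :+ x :* fx) :+ r :* (fr :+ x :* qx) := (c :+ r :* fr) :+ x :* (fx :+ r :* qx))
                   refl c x r (f x) (q x) (f r) ⟩
      (c + r * f r) + x * (f x + r * q x)
        ≈⟨ +-congˡ (*-congˡ (monic-division (c′ ∷ cs) r x)) ⟩
      (c + r * f r) + x * (x * q x + f r)
        ≈⟨ solve 5 (λ c x r qx fr → (c :+ r :* fr) :+ x :* (x :* qx :+ fr) := x :* (fr :+ x :* qx) :+ (c :+ r :* fr))
                   refl c x r (q x) (f r) ⟩
      x * (f r + x * q x) + (c + r * f r) ∎
    where
    open SetoidReasoning setoid
    f = monic (c′ ∷ cs)
    q = monic (quotient r (c′ ∷ cs))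

  monic-root : ∀ {d} (cs : Vec Carrier (suc d)) {r x} → monic cs r ≈ 0# → monic cs x ≈ 0# →
               x ≈ r ⊎ monic (quotient r cs) x ≈ 0#
  monic-root cs {r} {x} fr≈0 fx≈0 with monic (quotient r cs) x ≟ 0#
  ... | yes qx≈0 = inj₂ qx≈0
  ... | no  qx≉0 = inj₁ (sym (*-cancelʳ qx≉0 (begin
      r * q                   ≈⟨ sym (+-identityˡ _) ⟩
      0# + r * q              ≈⟨ +-congʳ (sym fx≈0) ⟩
      monic cs x + r * q      ≈⟨ monic-division cs r x ⟩
      x * q + monic cs r      ≈⟨ +-congˡ fr≈0 ⟩
      x * q + 0#              ≈⟨ +-identityʳ _ ⟩
      x * q                   ∎)))
    where
    open SetoidReasoning setoid
    q = monic (quotient r cs) x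

  root? : ∀ {d} (cs : Vec Carrier d) x → Dec (monic cs x ≈ 0#)
  root? cs x = monic cs x ≟ 0#

  roots-≤-degree : ∀ {d} (cs : Vec Carrier d) → count (root? cs) ≤ d
  roots-≤-degree [] = ℕ.≤-reflexive (count-empty (root? []) λ _ → 1≉0)
  roots-≤-degree {suc d} cs with Fin.any? (root? cs ∘ element)
  ... | no no-root = ℕ.≤-trans (ℕ.≤-reflexive (count-empty (root? cs) λ i fᵢ≈0 → no-root (i , fᵢ≈0))) z≤n
  ... | yes (i , fᵢ≈0) = begin
      count (root? cs)                                 ≤⟨ count-⊎ (root? cs) (_≟ r) (root? (quotient r cs)) (monic-root cs fᵢ≈0) ⟩
      count (_≟ r) ℕ.+ count (root? (quotient r cs))   ≡⟨ P.cong (ℕ._+ count (root? (quotient r cs))) (count-≈ r) ⟩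
      suc (count (root? (quotient r cs)))              ≤⟨ s≤s (roots-≤-degree (quotient r cs)) ⟩
      suc d                                            ∎
    where
    open ℕ.≤-Reasoning
    r = element i

  roots-of-unity : ∀ j .{{_ : NonZero j}} → count (λ x → pow x j ≟ 1#) ≤ j
  roots-of-unity (suc j) =
    ℕ.≤-trans (count-mono (λ x → pow x (suc j) ≟ 1#) (root? (- 1# ∷ replicate j 0#)) root) (roots-≤-degree (- 1# ∷ replicate j 0#))
    where
    monic-0s : ∀ j x → monic (replicate j 0#) x ≈ pow x j
    monic-0s zero    x = refl
    monic-0s (suc j) x = trans (+-identityˡ _) (*-congˡ (monic-0s j x))
    root : ∀ {x} → pow x (suc j) ≈ 1# → - 1# + x * monic (replicate j 0#) x ≈ 0#
    root {x} xʲ⁺¹≈1 = trans (+-congˡ (trans (*-congˡ (monic-0s j x)) xʲ⁺¹≈1)) (-‿inverseˡ 1#)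

module EulerCriterion {c ℓ} (F : Field c ℓ) {n : ℕ} (enum : Inverse (P.setoid (Fin n)) (Field.setoid F))
                      (k : ℕ) .{{_ : NonZero k}} (n≡2k+1 : n ≡ suc (k ℕ.+ k)) where
  open Field F
  open FieldNotions F
  open FieldProperties F
  open FiniteField F enum
  open Counting F enum
  open IntegerCoefficientSolver commutativeRing using (solve; _:+_; _:*_; :-_; _:=_; con)

  pow-2k≈1 : ∀ {x} → x ≉ 0# → pow x (k ℕ.+ k) ≈ 1#
  pow-2k≈1 {x} x≉0 = *-cancelˡ x≉0 (trans (P.subst (λ m → pow x m ≈ x) n≡2k+1 (fermat x≉0)) (sym (*-identityʳ x)))

  NonzeroSquare : Carrier → Set _
  NonzeroSquare x = x ≉ 0# ∧ IsSquare x

  square? : ∀ x → Dec (IsSquare x)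
  square? x with Fin.any? (λ i → element i * element i ≟ x)
  ... | yes (i , eᵢ²≈x) = yes (element i , eᵢ²≈x)
  ... | no  ¬root       = no λ (y , y²≈x) → ¬root (index y , trans (*-cong (strictlyInverseˡ y) (strictlyInverseˡ y)) y²≈x)

  nonzero? : ∀ x → Dec (x ≉ 0#)
  nonzero? x = ¬? (x ≟ 0#)

  nonzeroSquare? : ∀ x → Dec (NonzeroSquare x)
  nonzeroSquare? x = nonzero? x ×-dec square? x

  #nonzero≡2k : count nonzero? ≡ k ℕ.+ k
  #nonzero≡2k = ℕ.suc-injective (begin
    suc (count nonzero?)                                          ≡⟨ P.cong (ℕ._+ count nonzero?) (P.sym (count-≈ 0#)) ⟩
    count (_≟ 0#) ℕ.+ count nonzero?                              ≡⟨ P.sym (∑ℕ.∑-distrib-+ {n} (𝟙 ∘ (_≟ 0#) ∘ element) (𝟙 ∘ nonzero? ∘ element)) ⟩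
    ∑ℕ.sum {n} (λ i → 𝟙 (element i ≟ 0#) ℕ.+ 𝟙 (nonzero? (element i)))  ≡⟨ ∑ℕ.sum-cong-≗ (λ i → 𝟙+𝟙-¬? (element i ≟ 0#)) ⟩
    ∑ℕ.sum {n} (λ _ → 1)                                          ≡⟨ ∑-1 n ⟩
    n                                                             ≡⟨ n≡2k+1 ⟩
    suc (k ℕ.+ k)                                                 ∎)
    where
    open P.≡-Reasoning
    𝟙+𝟙-¬? : ∀ {a} {A : Set a} (a? : Dec A) → 𝟙 a? ℕ.+ 𝟙 (¬? a?) ≡ 1
    𝟙+𝟙-¬? (yes _) = P.refl
    𝟙+𝟙-¬? (no  _) = P.refl
    ∑-1 : ∀ m → ∑ℕ.sum {m} (λ _ → 1) ≡ m
    ∑-1 zero    = P.refl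
    ∑-1 (suc m) = P.cong suc (∑-1 m)

  -- Double counting the pairs (y , y²) with y ≉ 0: every nonzero square has at most two square roots.
  squaring? : (i j : Fin n) → Dec (element i ≉ 0# ∧ element j ≈ element i * element i)
  squaring? i j = nonzero? (element i) ×-dec (element j ≟ element i * element i)

  #squares-of : ∀ i → ∑ℕ.sum {n} (λ j → 𝟙 (squaring? i j)) ≡ 𝟙 (nonzero? (element i))
  #squares-of i = by-cases (element i ≟ 0#)
    where
    eᵢ² = element i * element i
    by-cases : (d : Dec (element i ≈ 0#)) → ∑ℕ.sum {n} (λ j → 𝟙 (squaring? i j)) ≡ 𝟙 (¬? d)
    by-cases (yes eᵢ≈0) = count-empty (λ y → nonzero? (element i) ×-dec (y ≟ eᵢ²)) λ _ (eᵢ≉0 , _) → eᵢ≉0 eᵢ≈0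
    by-cases (no  eᵢ≉0) = P.trans (count-≡ (λ y → nonzero? (element i) ×-dec (y ≟ eᵢ²)) (_≟ eᵢ²) proj₂ (eᵢ≉0 ,_))
                                  (count-≈ eᵢ²)

  #square-roots-of : ∀ j → ∑ℕ.sum {n} (λ i → 𝟙 (squaring? i j)) ≤ 𝟙 (nonzeroSquare? (element j)) ℕ.+ 𝟙 (nonzeroSquare? (element j))
  #square-roots-of j with nonzeroSquare? (element j)
  ... | no ¬square = ℕ.≤-reflexive (count-empty (λ y → nonzero? y ×-dec (element j ≟ y * y)) λ i (eᵢ≉0 , eⱼ≈eᵢ²) →
                       ¬square ((λ eⱼ≈0 → *-≉0 eᵢ≉0 eᵢ≉0 (trans (sym eⱼ≈eᵢ²) eⱼ≈0)) , (element i , sym eⱼ≈eᵢ²)))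
  ... | yes _      = ℕ.≤-trans (count-mono (λ y → nonzero? y ×-dec (element j ≟ y * y)) (root? (- element j ∷ 0# ∷ []))
                                 λ {y} (_ , eⱼ≈y²) → trans (+-congʳ (-‿cong eⱼ≈y²)) (-y²+y[0+y1]≈0 y))
                               (roots-≤-degree (- element j ∷ 0# ∷ []))
    where
    -y²+y[0+y1]≈0 : ∀ y → - (y * y) + y * (0# + y * 1#) ≈ 0#
    -y²+y[0+y1]≈0 = solve 1 (λ y → :- (y :* y) :+ y :* (con (0 , 0) :+ y :* con (1 , 0)) := con (0 , 0)) refl

  k≤#nonzeroSquares : k ≤ count nonzeroSquare?
  k≤#nonzeroSquares = ℕ.*-cancelˡ-≤ 2 (begin
    2 ℕ.* k                                                   ≡⟨ P.cong (k ℕ.+_) (ℕ.+-identityʳ k) ⟩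
    k ℕ.+ k                                                   ≡⟨ P.sym #nonzero≡2k ⟩
    count nonzero?                                            ≡⟨ P.sym (∑ℕ.sum-cong-≗ #squares-of) ⟩
    ∑ℕ.sum {n} (λ i → ∑ℕ.sum {n} (λ j → 𝟙 (squaring? i j)))   ≡⟨ ∑ℕ.∑-comm {n} {n} (λ i j → 𝟙 (squaring? i j)) ⟩
    ∑ℕ.sum {n} (λ j → ∑ℕ.sum {n} (λ i → 𝟙 (squaring? i j)))   ≤⟨ ∑-mono-≤ _ _ #square-roots-of ⟩
    ∑ℕ.sum {n} (λ j → 𝟙 (nonzeroSquare? (element j)) ℕ.+ 𝟙 (nonzeroSquare? (element j)))
      ≡⟨ ∑ℕ.∑-distrib-+ {n} (𝟙 ∘ nonzeroSquare? ∘ element) (𝟙 ∘ nonzeroSquare? ∘ element) ⟩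
    count nonzeroSquare? ℕ.+ count nonzeroSquare?             ≡⟨ P.cong (count nonzeroSquare? ℕ.+_) (P.sym (ℕ.+-identityʳ _)) ⟩
    2 ℕ.* count nonzeroSquare?                                ∎)
    where open ℕ.≤-Reasoning

  nonzeroSquare⇒pow-k≈1 : ∀ {y} → NonzeroSquare y → pow y k ≈ 1#
  nonzeroSquare⇒pow-k≈1 (y≉0 , (z , z²≈y)) =
    trans (pow-cong k (sym z²≈y)) (trans (pow-square z k) (pow-2k≈1 (root-≉0 z²≈y y≉0)))

  -- The nonzero squares are k roots of x ↦ x ^ k − 1, which has at most k roots.
  euler-criterion : ∀ {x} → x ≉ 0# → IsSquare x ⇔ pow x k ≈ 1#
  euler-criterion {x} x≉0 = mk⇔ (λ x-square → nonzeroSquare⇒pow-k≈1 (x≉0 , x-square)) pow-k≈1⇒square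
    where
    pow-k≈1⇒square : pow x k ≈ 1# → IsSquare x
    pow-k≈1⇒square xᵏ≈1 with square? x
    ... | yes x-square = x-square
    ... | no  ¬square  = ⊥-elim (ℕ.<⇒≱ (ℕ.≤-<-trans k≤#nonzeroSquares #squares<#roots) (roots-of-unity k))
      where
      #squares<#roots : count nonzeroSquare? < count (λ y → pow y k ≟ 1#)
      #squares<#roots = count-mono-< nonzeroSquare? (λ y → pow y k ≟ 1#) nonzeroSquare⇒pow-k≈1 (index x)
        (λ (_ , (z , z²≈e)) → ¬square (z , trans z²≈e (strictlyInverseˡ x)))
        (trans (pow-cong k (strictlyInverseˡ x)) xᵏ≈1)

¬-cong : ∀ {a b} {A : Set a} {B : Set b} → A ⇔ B → (¬ A) ⇔ (¬ B)
¬-cong A⇔B = mk⇔ (contraposition (Equivalence.from A⇔B)) (contraposition (Equivalence.to A⇔B))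

module QuadraticExtension {c ℓ} (F : Field c ℓ) {p : ℕ} (p-prime : Prime p) (m h : ℕ) .{{_ : NonZero h}}
                          (pᵐ≡2h+1 : p ℕ.^ m ≡ suc (h ℕ.+ h))
                          (enum : Inverse (P.setoid (Fin (p ℕ.^ m ℕ.* p ℕ.^ m))) (Field.setoid F)) where
  open Field F
  open FieldNotions F
  open FieldProperties F
  open FiniteField F enum
  open Frobenius commutativeRing using (frobenius)
  open import Algebra.Properties.Ring ring using (+-inverseˡ-unique)
  open import Algebra.Properties.Semiring.Mult semiring using (_×_; ×-homo-+; ×1-homo-*)
  open SetoidReasoning setoid

  q : ℕ
  q = p ℕ.^ m

  -- (q² − 1) / 2
  k : ℕ
  k = h ℕ.* suc q

  open EulerCriterion F enum k {{ℕ.m*n≢0 h (suc q)}} (square-of-odd {h = h} pᵐ≡2h+1)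

  q×1≈0 : q × 1# ≈ 0#
  q×1≈0 = Sum.reduce (*-≈0 (trans (sym (×1-homo-* q q)) characteristic))

  char-p : p × 1# ≈ 0#
  char-p = pow-≈0 m (trans (sym (^×1≈pow p m)) q×1≈0)

  -- q is odd, so 1 + 1 ≈ 0 would give q × 1 ≈ 1.
  1≉-1 : 1# ≉ - 1#
  1≉-1 1≈-1 = 1≉0 (begin
    1#                   ≈⟨ sym (+-identityʳ 1#) ⟩
    1# + 0#              ≈⟨ +-congˡ (sym 2h×1≈0) ⟩
    suc (h ℕ.+ h) × 1#   ≡⟨ P.cong (_× 1#) (P.sym pᵐ≡2h+1) ⟩
    q × 1#               ≈⟨ q×1≈0 ⟩
    0#                   ∎)
    where
    open IntegerCoefficientSolver commutativeRing using (solve; _:+_; _:*_; _:=_; con)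
    2h×1≈0 : (h ℕ.+ h) × 1# ≈ 0#
    2h×1≈0 = begin
      (h ℕ.+ h) × 1#          ≈⟨ ×-homo-+ 1# h h ⟩
      h × 1# + h × 1#         ≈⟨ solve 1 (λ a → a :+ a := con (2 , 0) :* a) refl (h × 1#) ⟩
      (1# + 1#) * (h × 1#)    ≈⟨ *-congʳ (trans (+-congˡ 1≈-1) (-‿inverseʳ 1#)) ⟩
      0# * (h × 1#)           ≈⟨ zeroˡ _ ⟩
      0#                      ∎

  φ : Carrier → Carrier
  φ = conj q

  φ-cong : ∀ {x y} → x ≈ y → φ x ≈ φ y
  φ-cong = pow-cong q

  φ-+ : ∀ x y → φ (x + y) ≈ φ x + φ y
  φ-+ x y = trans (pow≈^ (x + y) q) (trans (frobenius p-prime char-p m x y) (sym (+-cong (pow≈^ x q) (pow≈^ y q))))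

  φ-0 : φ 0# ≈ 0#
  φ-0 = P.subst (λ e → pow 0# e ≈ 0#) (P.sym pᵐ≡2h+1) (zeroˡ _)

  φ-neg : ∀ x → φ (- x) ≈ - φ x
  φ-neg x = +-inverseˡ-unique (φ (- x)) (φ x) (trans (sym (φ-+ (- x) x)) (trans (φ-cong (-‿inverseˡ x)) φ-0))

  φ-involutive : ∀ {x} → x ≉ 0# → φ (φ x) ≈ x
  φ-involutive {x} x≉0 = trans (sym (pow-* x q q)) (fermat x≉0)

  χ : Carrier → Carrier
  χ x = pow x h

  χ-* : ∀ x y → χ (x * y) ≈ χ x * χ y
  χ-* x y = pow-distrib-* x y h

  fixed⇒pow-2h≈1 : ∀ {x} → InSub q x → x ≉ 0# → pow x (h ℕ.+ h) ≈ 1#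
  fixed⇒pow-2h≈1 {x} x-fixed x≉0 =
    *-cancelˡ x≉0 (trans (P.subst (λ e → pow x e ≈ x) pᵐ≡2h+1 x-fixed) (sym (*-identityʳ x)))

  pow-2h≈1⇒fixed : ∀ {x} → pow x (h ℕ.+ h) ≈ 1# → InSub q x
  pow-2h≈1⇒fixed {x} x²ʰ≈1 = P.subst (λ e → pow x e ≈ x) (P.sym pᵐ≡2h+1) (trans (*-congˡ x²ʰ≈1) (*-identityʳ x))

  χ-≈±1 : ∀ {x} → InSub q x → x ≉ 0# → χ x ≈ 1# ⊎ χ x ≈ - 1#
  χ-≈±1 {x} x-fixed x≉0 = square-≈ (trans (sym (pow-+ x h h)) (trans (fixed⇒pow-2h≈1 x-fixed x≉0) (sym (*-identityˡ 1#))))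

  -- Euler's criterion for GF(q), derived from the one for GF(q²): a square root y of x lies in GF(q) iff y²ʰ ≈ 1.
  χ≈1⇔square : ∀ {x} → InSub q x → x ≉ 0# → (χ x ≈ 1# ⇔ IsSquareSub q x)
  χ≈1⇔square {x} x-fixed x≉0 = mk⇔ χ≈1⇒square square⇒χ≈1
    where
    χ≈1⇒square : χ x ≈ 1# → IsSquareSub q x
    χ≈1⇒square χx≈1 with Equivalence.from (euler-criterion x≉0) xᵏ≈1
      where
      xᵏ≈1 : pow x k ≈ 1#
      xᵏ≈1 = trans (pow-* x h (suc q)) (trans (pow-cong (suc q) χx≈1) (pow-1# (suc q)))
    ... | y , y²≈x = y , pow-2h≈1⇒fixed (trans (sym (pow-square y h)) (trans (pow-cong h y²≈x) χx≈1)) , y²≈x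
    square⇒χ≈1 : IsSquareSub q x → χ x ≈ 1#
    square⇒χ≈1 (y , y-fixed , y²≈x) =
      trans (pow-cong h (sym y²≈x)) (trans (pow-square y h) (fixed⇒pow-2h≈1 y-fixed (root-≉0 y²≈x x≉0)))

  nonsquare⇒χ≈-1 : ∀ {x} → InSub q x → x ≉ 0# → ¬ IsSquareSub q x → χ x ≈ - 1#
  nonsquare⇒χ≈-1 {x} x-fixed x≉0 x-nonsquare =
    Sum.[ (λ χx≈1 → contradiction (Equivalence.to (χ≈1⇔square x-fixed x≉0) χx≈1) x-nonsquare) , id ]′
          (χ-≈±1 x-fixed x≉0)

  χ-square : ∀ {z c} → z ≉ 0# → φ z ≈ c * z → χ (z * z) ≈ c
  χ-square {z} {c} z≉0 φz≈cz = trans (pow-square z h) (*-cancelˡ z≉0 (begin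
    z * pow z (h ℕ.+ h)  ≡⟨ P.cong (pow z) (P.sym pᵐ≡2h+1) ⟩
    φ z                  ≈⟨ φz≈cz ⟩
    c * z                ≈⟨ *-comm c z ⟩
    z * c                ∎))

  square⇔χ-norm : ∀ {γ} → γ ≉ 0# → (IsSquare γ ⇔ χ (γ * φ γ) ≈ 1#)
  square⇔χ-norm {γ} γ≉0 = mk⇔ (λ γ-square → trans (sym γᵏ≈χ[norm]) (Equivalence.to (euler-criterion γ≉0) γ-square))
                              (λ χ[norm]≈1 → Equivalence.from (euler-criterion γ≉0) (trans γᵏ≈χ[norm] χ[norm]≈1))
    where
    γᵏ≈χ[norm] : pow γ k ≈ χ (γ * φ γ)
    γᵏ≈χ[norm] = trans (reflexive (P.cong (pow γ) (ℕ.*-comm h (suc q)))) (pow-* γ (suc q) h)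

  module Conjugates {γ : Carrier} (γ²≉γ̄² : γ * γ ≉ φ γ * φ γ) (s-fixed : InSub q (γ / φ γ + φ γ / γ)) where
    open import Algebra.Properties.Ring ring using (x∙y⁻¹≈ε⇒x≈y; -‿involutive; -0#≈0#; -1*x≈-x)
    open IntegerCoefficientSolver commutativeRing using (solve; _:+_; _:*_; :-_; _:-_; _:=_; con)

    γ̄ s : Carrier
    γ̄ = φ γ
    s = γ / γ̄ + γ̄ / γ

    γ≉0 : γ ≉ 0#
    γ≉0 γ≈0 = γ²≉γ̄² (trans (*-cong γ≈0 γ≈0) (sym (*-cong γ̄≈0 γ̄≈0)))
      where γ̄≈0 = trans (φ-cong γ≈0) φ-0

    γ̄≉0 : γ̄ ≉ 0#
    γ̄≉0 = pow-≉0 q γ≉0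

    γ+γ̄≉0 : γ + γ̄ ≉ 0#
    γ+γ̄≉0 γ+γ̄≈0 = γ²≉γ̄² (trans (*-cong γ≈-γ̄ γ≈-γ̄) (solve 1 (λ x → :- x :* :- x := x :* x) refl γ̄))
      where γ≈-γ̄ = +-inverseˡ-unique γ γ̄ γ+γ̄≈0

    γ-γ̄≉0 : γ - γ̄ ≉ 0#
    γ-γ̄≉0 γ-γ̄≈0 = γ²≉γ̄² (*-cong γ≈γ̄ γ≈γ̄)
      where γ≈γ̄ = x∙y⁻¹≈ε⇒x≈y γ γ̄ γ-γ̄≈0

    φ[γ+γ̄] : φ (γ + γ̄) ≈ 1# * (γ + γ̄)
    φ[γ+γ̄] = trans (φ-+ γ γ̄) (trans (+-congˡ (φ-involutive γ≉0)) (trans (+-comm _ _) (sym (*-identityˡ _))))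

    φ[γ-γ̄] : φ (γ - γ̄) ≈ - 1# * (γ - γ̄)
    φ[γ-γ̄] = trans (φ-+ γ (- γ̄)) (trans (+-congˡ (trans (φ-neg γ̄) (-‿cong (φ-involutive γ≉0))))
               (solve 2 (λ x y → y :+ :- x := :- con (1 , 0) :* (x :- y)) refl γ γ̄))

    φ-2# : φ 2# ≈ 2#
    φ-2# = trans (φ-+ 1# 1#) (+-cong (pow-1# q) (pow-1# q))

    s+2-fixed : InSub q (s + 2#)
    s+2-fixed = trans (φ-+ s 2#) (+-cong s-fixed φ-2#)

    -s+2-fixed : InSub q (- s + 2#)
    -s+2-fixed = trans (φ-+ (- s) 2#) (+-cong (trans (φ-neg s) (-‿cong s-fixed)) φ-2#)

    -1-fixed : InSub q (- 1#)
    -1-fixed = trans (φ-neg 1#) (-‿cong (pow-1# q))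

    -1≉0 : - 1# ≉ 0#
    -1≉0 -1≈0 = 1≉0 (trans (sym (-‿involutive 1#)) (trans (-‿cong -1≈0) -0#≈0#))

    s+2≉0 : s + 2# ≉ 0#
    s+2≉0 s+2≈0 = *-≉0 γ+γ̄≉0 γ+γ̄≉0
      (trans (sym ([x/y+y/x+2]*xy≈[x+y]² γ≉0 γ̄≉0)) (trans (*-congʳ s+2≈0) (zeroˡ _)))

    -s+2≉0 : - s + 2# ≉ 0#
    -s+2≉0 -s+2≈0 = *-≉0 -1≉0 (*-≉0 γ-γ̄≉0 γ-γ̄≉0)
      (trans (sym ([-[x/y+y/x]+2]*xy≈-[x-y]² γ≉0 γ̄≉0)) (trans (*-congʳ -s+2≈0) (zeroˡ _)))

    χ[s+2]*χ[γγ̄]≈1 : χ (s + 2#) * χ (γ * γ̄) ≈ 1#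
    χ[s+2]*χ[γγ̄]≈1 = begin
      χ (s + 2#) * χ (γ * γ̄)     ≈⟨ sym (χ-* _ _) ⟩
      χ ((s + 2#) * (γ * γ̄))     ≈⟨ pow-cong h ([x/y+y/x+2]*xy≈[x+y]² γ≉0 γ̄≉0) ⟩
      χ ((γ + γ̄) * (γ + γ̄))      ≈⟨ χ-square γ+γ̄≉0 φ[γ+γ̄] ⟩
      1#                        ∎

    χ[-s+2]*χ[γγ̄]≈χ[-1]*-1 : χ (- s + 2#) * χ (γ * γ̄) ≈ χ (- 1#) * - 1#
    χ[-s+2]*χ[γγ̄]≈χ[-1]*-1 = begin
      χ (- s + 2#) * χ (γ * γ̄)             ≈⟨ sym (χ-* _ _) ⟩
      χ ((- s + 2#) * (γ * γ̄))             ≈⟨ pow-cong h ([-[x/y+y/x]+2]*xy≈-[x-y]² γ≉0 γ̄≉0) ⟩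
      χ (- 1# * ((γ - γ̄) * (γ - γ̄)))       ≈⟨ χ-* _ _ ⟩
      χ (- 1#) * χ ((γ - γ̄) * (γ - γ̄))     ≈⟨ *-congˡ (χ-square γ-γ̄≉0 φ[γ-γ̄]) ⟩
      χ (- 1#) * - 1#                     ∎

    s+2-square⇔χ[γγ̄]≈1 : IsSquareSub q (s + 2#) ⇔ χ (γ * γ̄) ≈ 1#
    s+2-square⇔χ[γγ̄]≈1 = ⇔-trans (⇔-sym (χ≈1⇔square s+2-fixed s+2≉0)) (x*y≈1⇒x≈1⇔y≈1 χ[s+2]*χ[γγ̄]≈1)

    square⇔s+2-square : IsSquare γ ⇔ IsSquareSub q (s + 2#)
    square⇔s+2-square = ⇔-trans (square⇔χ-norm γ≉0) (⇔-sym s+2-square⇔χ[γγ̄]≈1)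

    -1-nonsquare⇒s+2-square⇔-s+2-square : ¬ IsSquareSub q (- 1#) → IsSquareSub q (s + 2#) ⇔ IsSquareSub q (- s + 2#)
    -1-nonsquare⇒s+2-square⇔-s+2-square -1-nonsquare =
      ⇔-trans s+2-square⇔χ[γγ̄]≈1 (⇔-trans (⇔-sym (x*y≈1⇒x≈1⇔y≈1 χ[-s+2]*χ[γγ̄]≈1)) (χ≈1⇔square -s+2-fixed -s+2≉0))
      where
      χ[-s+2]*χ[γγ̄]≈1 : χ (- s + 2#) * χ (γ * γ̄) ≈ 1#
      χ[-s+2]*χ[γγ̄]≈1 = begin
        χ (- s + 2#) * χ (γ * γ̄)  ≈⟨ χ[-s+2]*χ[γγ̄]≈χ[-1]*-1 ⟩
        χ (- 1#) * - 1#          ≈⟨ *-congʳ (nonsquare⇒χ≈-1 -1-fixed -1≉0 -1-nonsquare) ⟩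
        - 1# * - 1#              ≈⟨ -1*x≈-x (- 1#) ⟩
        - - 1#                   ≈⟨ -‿involutive 1# ⟩
        1#                       ∎

    -1-square⇒s+2-square⇔-s+2-nonsquare : IsSquareSub q (- 1#) → IsSquareSub q (s + 2#) ⇔ (¬ IsSquareSub q (- s + 2#))
    -1-square⇒s+2-square⇔-s+2-nonsquare -1-square =
      ⇔-trans s+2-square⇔χ[γγ̄]≈1
        (⇔-trans (x*y≈-1⇒x≈1⇔y≉1 1≉-1 (χ-≈±1 -s+2-fixed -s+2≉0) χ[γγ̄]*χ[-s+2]≈-1) (¬-cong (χ≈1⇔square -s+2-fixed -s+2≉0)))
      where
      χ[γγ̄]*χ[-s+2]≈-1 : χ (γ * γ̄) * χ (- s + 2#) ≈ - 1#
      χ[γγ̄]*χ[-s+2]≈-1 = begin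
        χ (γ * γ̄) * χ (- s + 2#)  ≈⟨ *-comm _ _ ⟩
        χ (- s + 2#) * χ (γ * γ̄)  ≈⟨ χ[-s+2]*χ[γγ̄]≈χ[-1]*-1 ⟩
        χ (- 1#) * - 1#          ≈⟨ *-congʳ (Equivalence.from (χ≈1⇔square -1-fixed -1≉0) -1-square) ⟩
        1# * - 1#                ≈⟨ *-identityˡ _ ⟩
        - 1#                     ∎

open import Data.Product using (_×_)
open import Relation.Binary.PropositionalEquality using (setoid; refl)

lemma4p12 : ∀ {c ℓ : Level} (F : Field c ℓ) (p m : ℕ) → Prime p → p ≢ 2 → 1 ≤ m →
    Inverse (setoid (Fin ((p ℕ.^ m) ℕ.* (p ℕ.^ m)))) (Field.setoid F) →
    let open Field F
        open FieldNotions F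
        q = p ℕ.^ m
    in (γ : Carrier) →
    ¬ (γ * γ ≈ conj q γ * conj q γ) →
    let s = (γ / conj q γ) + (conj q γ / γ)
        κ = s * s
    in ¬ (κ ≈ 0#) → InSub q κ → InSub q s →
    ((¬ IsSquareSub q (- 1#)) →
       (IsSquare γ ⇔ IsSquareSub q (s + 2#)) × (IsSquareSub q (s + 2#) ⇔ IsSquareSub q (- s + 2#)))
    ×
    (IsSquareSub q (- 1#) →
       (IsSquare γ ⇔ IsSquareSub q (s + 2#)) × (IsSquareSub q (s + 2#) ⇔ (¬ IsSquareSub q (- s + 2#))))
lemma4p12 F p ℕ.zero    _       _   ()
lemma4p12 F p (ℕ.suc m) p-prime p≢2 _ enum γ γ²≉γ̄² _ _ s-fixed with odd-prime p-prime p≢2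
... | r , refl with odd-prime-power r m
... | h , q≡2h+3 =
  (λ -1-nonsquare → square⇔s+2-square , -1-nonsquare⇒s+2-square⇔-s+2-square -1-nonsquare) ,
  (λ -1-square → square⇔s+2-square , -1-square⇒s+2-square⇔-s+2-nonsquare -1-square)
  where
  open QuadraticExtension F p-prime (ℕ.suc m) (ℕ.suc h) q≡2h+3 enum
  open Conjugates γ²≉γ̄² s-fixed
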